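{- Let $\mathcal{C}^{\mathbf{pre}}_{\mathbf{epi}}$ be the class of all prestandard epistemic frames and $\mathcal{C}^{\mathbf{sta}}_{\mathbf{epi}}$ the class of all standard epistemic frames. Then $\mathtt{Log}(\mathcal{C}^{\mathbf{pre}}_{\mathbf{epi}})=\mathtt{Log}(\mathcal{C}^{\mathbf{sta}}_{\mathbf{epi}})$. Here: - a frame is epistemic if $sR(\alpha)t$ implies $s\leq t$ for all groups $\alpha$ and all $s,t$, and for every group $\alpha$ and every $s$ there is $t$ with $s\,(\leq\circ R(\alpha))\,t$; - it is prestandard if $R(\alpha\cup\beta)\subseteq R(\alpha)\cap R(\beta)$ for all groups $\alpha,\beta$; - it is standard if $R(\alpha\cup\beta)=R(\alpha)\cap R(\beta)$ for all groups $\alpha,\beta$.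
   Context: **Language.** Let $\mathbf{At}$ be a countably infinite set of atoms and let $\mathbf{Ag}$ be a finite set of agents. A group is a nonempty subset of $\mathbf{Ag}$. Formulas are generated by $$A ::= p \mid (A\rightarrow A) \mid \top \mid \bot \mid (A\vee A) \mid (A\wedge A) \mid [\alpha]A \mid \langle\alpha\rangle A.$$ **Frames.** A frame is a triple $(W,\leq,R)$ where $W$ is a nonempty set, $\leq$ is a preorder on $W$, and $R$ assigns to each group $\alpha$ a binary relation $R(\alpha)$ on $W$. For binary relations $S,T$, write $s\,(S\circ T)\,t$ iff there is $u$ with $sSu$ and $uTt$. Write $\geq$ for the converse of $\leq$. **Models and satisfaction.** A valuation is a map $V:\mathbf{At}\to\wp(W)$ with each $V(p)$ upward closed under $\leq$. Satisfaction in a model $(W,\leq,R,V)$ is defined as follows: - $s\models p$ iff $s\in V(p)$; - $s\models A\rightarrow B$ iff for all $t\geq s$, either $t\not\models A$ or $t\models B$; - $s\models\top$, and $s\not\models\bot$; - $\vee$ and $\wedge$ are interpreted pointwise; - $s\models[\alpha]A$ iff for all $t$ with $s\,(\leq\circ R(\alpha))\,t$, $t\models A$; - $s\models\langle\alpha\rangle A$ iff there is $t$ with $s\,(\geq\circ R(\alpha))\,t$ and $t\models A$. A formula is valid in a frame if it is satisfied at every state of every model based on that frame. For a class $\mathcal{C}$ of frames, $\mathtt{Log}(\mathcal{C})$ is the set of formulas valid in every frame in $\mathcal{C}$. -}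

module Defs where

open import Level using (Level; suc; _⊔_) renaming (zero to lzero)
open import Data.Nat using (ℕ)
open import Data.Fin.Subset using (Subset; Nonempty; _∪_)
open import Data.Product using (Σ; ∃; _×_; _,_)
open import Data.Sum using (_⊎_)
open import Data.Empty using (⊥)
open import Data.Unit using (⊤)
open import Relation.Nullary using (¬_)
open import Relation.Binary.PropositionalEquality using (_≡_)
open import Relation.Binary.Structures using (IsPreorder)

Atom : Set
Atom = ℕ

Group : ℕ → Set
Group n = Σ (Subset n) Nonempty

data Form (n : ℕ) : Set where
  atom : Atom → Form n
  _⇒_  : Form n → Form n → Form n
  ⊤f   : Form n
  ⊥f   : Form n
  _∨f_ : Form n → Form n → Form n
  _∧f_ : Form n → Form n → Form n
  box  : Group n → Form n → Form n
  dia  : Group n → Form n → Form n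

-- A frame over agents Fin n.  R is given on all subsets; only its values on
-- nonempty subsets (groups) are ever used.
record Frame (n : ℕ) : Set₁ where
  field
    W        : Set
    inhabited : W
    _≤_      : W → W → Set
    isPreorder : IsPreorder _≡_ _≤_
    R        : Subset n → W → W → Set

module _ {n : ℕ} (F : Frame n) where
  open Frame F

  ≤∘R : Subset n → W → W → Set
  ≤∘R α s t = ∃ λ u → (s ≤ u) × R α u t

  ≥∘R : Subset n → W → W → Set
  ≥∘R α s t = ∃ λ u → (u ≤ s) × R α u t

  record Valuation : Set₁ where
    field
      V      : Atom → W → Set
      upward : ∀ p {s t} → s ≤ t → V p s → V p t

  _,_⊨_ : Valuation → W → Form n → Set
  M , s ⊨ atom p = Valuation.V M p s
  M , s ⊨ (A ⇒ B) = ∀ t → s ≤ t → ¬ (M , t ⊨ A) ⊎ (M , t ⊨ B)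
  M , s ⊨ ⊤f = ⊤
  M , s ⊨ ⊥f = ⊥
  M , s ⊨ (A ∨f B) = (M , s ⊨ A) ⊎ (M , s ⊨ B)
  M , s ⊨ (A ∧f B) = (M , s ⊨ A) × (M , s ⊨ B)
  M , s ⊨ box (α , _) A = ∀ t → ≤∘R α s t → M , t ⊨ A
  M , s ⊨ dia (α , _) A = ∃ λ t → ≥∘R α s t × (M , t ⊨ A)

  ValidIn : Form n → Set₁
  ValidIn A = ∀ (M : Valuation) (s : W) → M , s ⊨ A

  Epistemic : Set
  Epistemic =
    (∀ (α : Subset n) → Nonempty α → ∀ s t → R α s t → s ≤ t)
    × (∀ (α : Subset n) → Nonempty α → ∀ s → ∃ λ t → ≤∘R α s t)

  Prestandard : Set
  Prestandard = ∀ (α β : Subset n) → Nonempty α → Nonempty β → ∀ s t →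
    R (α ∪ β) s t → R α s t × R β s t

  Standard : Set
  Standard = ∀ (α β : Subset n) → Nonempty α → Nonempty β → ∀ s t →
    (R (α ∪ β) s t → R α s t × R β s t) × (R α s t × R β s t → R (α ∪ β) s t)

InLogPreEpi : {n : ℕ} → Form n → Set₁
InLogPreEpi {n} A = ∀ (F : Frame n) → Epistemic F → Prestandard F → ValidIn F A

InLogStaEpi : {n : ℕ} → Form n → Set₁
InLogStaEpi {n} A = ∀ (F : Frame n) → Epistemic F → Standard F → ValidIn F A

-- A prestandard frame is antitone in the group: if α ⊆ δ then R(δ) = R(α ∪ δ) ⊆ R(α).
-- Its standard cover has as worlds the pairs (s, δ) of a state and the group δ by which
-- it was reached, with x R'(α) (t, δ) iff α ⊆ δ and (proj₁ x) R(δ) t. Since α ⊆ δ and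
-- β ⊆ δ iff α ∪ β ⊆ δ, the cover is standard; it stays epistemic, and by antitonicity
-- the projection to the first component is a surjective bounded morphism, so every
-- formula valid on the cover is valid on the original frame.
module Submission where

open import Defs
open import Data.Nat using (ℕ)
open import Data.Product using (_×_; _,_; proj₁; ∃)
open import Data.Sum using (inj₁; inj₂; [_,_]′)
open import Data.Fin.Subset using (Subset; Nonempty; _∪_; _⊆_)
open import Data.Fin.Subset.Properties using (x∈p∪q⁻; p⊆p∪q; q⊆p∪q; ⊆-refl; ⊆-antisym)
open import Relation.Binary.PropositionalEquality using (_≡_; refl; sym; cong; subst; isEquivalence)
open import Relation.Binary.Structures using (IsPreorder)
import Data.Fin.Subset as Subset

∪-lub : ∀ {n} {α β δ : Subset n} → α ⊆ δ → β ⊆ δ → α ∪ β ⊆ δ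
∪-lub {α = α} {β} α⊆δ β⊆δ x∈α∪β = [ α⊆δ , β⊆δ ]′ (x∈p∪q⁻ α β x∈α∪β)

⊆⇒∪≡ʳ : ∀ {n} {α δ : Subset n} → α ⊆ δ → α ∪ δ ≡ δ
⊆⇒∪≡ʳ {α = α} {δ} α⊆δ = ⊆-antisym (∪-lub α⊆δ ⊆-refl) (q⊆p∪q α δ)

standard⇒prestandard : ∀ {n} (F : Frame n) → Standard F → Prestandard F
standard⇒prestandard F standard α β ne-α ne-β s t = proj₁ (standard α β ne-α ne-β s t)

prestandard⇒R-antitone : ∀ {n} (F : Frame n) → Prestandard F →
  ∀ {α δ} → Nonempty α → Nonempty δ → α ⊆ δ → ∀ {s t} →
  Frame.R F δ s t → Frame.R F α s t
prestandard⇒R-antitone F prestandard {α} {δ} ne-α ne-δ α⊆δ {s} {t} sRδt =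
  proj₁ (prestandard α δ ne-α ne-δ s t (subst (λ γ → Frame.R F γ s t) (sym (⊆⇒∪≡ʳ α⊆δ)) sRδt))

module _ {n : ℕ} (G F : Frame n) where
  private
    module G = Frame G
    module F = Frame F

  record BoundedMorphism : Set where
    field
      map       : G.W → F.W
      monotone  : ∀ {x y} → x G.≤ y → map x F.≤ map y
      ≤-back    : ∀ x {t} → map x F.≤ t → ∃ λ y → x G.≤ y × map y ≡ t
      ≤∘R-forth : ∀ {α} → Nonempty α → ∀ {x y} → ≤∘R G α x y → ≤∘R F α (map x) (map y)
      ≤∘R-back  : ∀ {α} → Nonempty α → ∀ x {t} → ≤∘R F α (map x) t →
                  ∃ λ y → ≤∘R G α x y × map y ≡ t
      ≥∘R-forth : ∀ {α} → Nonempty α → ∀ {x y} → ≥∘R G α x y → ≥∘R F α (map x) (map y)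
      ≥∘R-back  : ∀ {α} → Nonempty α → ∀ x {t} → ≥∘R F α (map x) t →
                  ∃ λ y → ≥∘R G α x y × map y ≡ t

module BoundedMorphism-Truth {n : ℕ} {G F : Frame n} (f : BoundedMorphism G F) where
  open BoundedMorphism f

  pullback : Valuation F → Valuation G
  pullback M = record
    { V      = λ p x → Valuation.V M p (map x)
    ; upward = λ p x≤y → Valuation.upward M p (monotone x≤y)
    }

  module _ (M : Valuation F) where
    ⊨-reflect  : ∀ A x → _,_⊨_ G (pullback M) x A → _,_⊨_ F M (map x) A
    ⊨-preserve : ∀ A x → _,_⊨_ F M (map x) A → _,_⊨_ G (pullback M) x A

    ⊨-reflect-at : ∀ A {x t} → map x ≡ t → _,_⊨_ G (pullback M) x A → _,_⊨_ F M t A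
    ⊨-reflect-at A refl = ⊨-reflect A _

    ⊨-reflect (atom p) x h = h
    ⊨-reflect (A ⇒ B) x h t mx≤t with ≤-back x mx≤t
    ... | y , x≤y , refl with h y x≤y
    ...   | inj₁ ¬A = inj₁ (λ a → ¬A (⊨-preserve A y a))
    ...   | inj₂ b  = inj₂ (⊨-reflect B y b)
    ⊨-reflect ⊤f x h = h
    ⊨-reflect ⊥f x h = h
    ⊨-reflect (A ∨f B) x (inj₁ a) = inj₁ (⊨-reflect A x a)
    ⊨-reflect (A ∨f B) x (inj₂ b) = inj₂ (⊨-reflect B x b)
    ⊨-reflect (A ∧f B) x (a , b) = ⊨-reflect A x a , ⊨-reflect B x b
    ⊨-reflect (box (α , ne) A) x h t path with ≤∘R-back ne x path
    ... | y , x↝y , my≡t = ⊨-reflect-at A my≡t (h y x↝y)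
    ⊨-reflect (dia (α , ne) A) x (y , x↝y , a) = map y , ≥∘R-forth ne x↝y , ⊨-reflect A y a

    ⊨-preserve (atom p) x h = h
    ⊨-preserve (A ⇒ B) x h y x≤y with h (map y) (monotone x≤y)
    ... | inj₁ ¬A = inj₁ (λ a → ¬A (⊨-reflect A y a))
    ... | inj₂ b  = inj₂ (⊨-preserve B y b)
    ⊨-preserve ⊤f x h = h
    ⊨-preserve ⊥f x h = h
    ⊨-preserve (A ∨f B) x (inj₁ a) = inj₁ (⊨-preserve A x a)
    ⊨-preserve (A ∨f B) x (inj₂ b) = inj₂ (⊨-preserve B x b)
    ⊨-preserve (A ∧f B) x (a , b) = ⊨-preserve A x a , ⊨-preserve B x b
    ⊨-preserve (box (α , ne) A) x h y x↝y = ⊨-preserve A y (h (map y) (≤∘R-forth ne x↝y))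
    ⊨-preserve (dia (α , ne) A) x (t , path , a) with ≥∘R-back ne x path
    ... | y , x↝y , refl = y , x↝y , ⊨-preserve A y a

  surjective⇒validIn-reflect : (∀ s → ∃ λ x → map x ≡ s) →
    ∀ A → ValidIn G A → ValidIn F A
  surjective⇒validIn-reflect surjective A valid M s with surjective s
  ... | x , refl = ⊨-reflect M A x (valid (pullback M) x)

module StandardCover {n : ℕ} (F : Frame n) where
  open Frame F

  _≤⁺_ : W × Subset n → W × Subset n → Set
  x ≤⁺ y = proj₁ x ≤ proj₁ y

  R⁺ : Subset n → W × Subset n → W × Subset n → Set
  R⁺ α x (t , δ) = Nonempty δ × α ⊆ δ × R δ (proj₁ x) t

  cover : Frame n
  cover = record
    { W          = W × Subset n
    ; inhabited  = inhabited , Subset.⊥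
    ; _≤_        = _≤⁺_
    ; isPreorder = record
      { isEquivalence = isEquivalence
      ; reflexive     = λ x≡y → IsPreorder.reflexive isPreorder (cong proj₁ x≡y)
      ; trans         = IsPreorder.trans isPreorder
      }
    ; R          = R⁺
    }

  cover-standard : Standard cover
  cover-standard α β _ _ _ _ =
    (λ (ne , α∪β⊆δ , r) → (ne , (λ i → α∪β⊆δ (p⊆p∪q β i)) , r)
                        , (ne , (λ i → α∪β⊆δ (q⊆p∪q α β i)) , r))
    , λ ((ne , α⊆δ , r) , (_ , β⊆δ , _)) → ne , ∪-lub α⊆δ β⊆δ , r

  cover-epistemic : Epistemic F → Epistemic cover
  cover-epistemic (R⊆≤ , serial) =
    (λ { _ _ x (t , δ) (ne , _ , r) → R⊆≤ δ ne (proj₁ x) t r })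
    , λ α ne x → let (t , u , s≤u , uRt) = serial α ne (proj₁ x) in
                 (t , α) , (u , α) , s≤u , ne , ⊆-refl , uRt

  projection : Prestandard F → BoundedMorphism cover F
  projection prestandard = record
    { map       = proj₁
    ; monotone  = λ x≤y → x≤y
    ; ≤-back    = λ (_ , δ) {t} s≤t → (t , δ) , s≤t , refl
    ; ≤∘R-forth = λ ne-α ((u , _) , s≤u , ne-δ , α⊆δ , r) →
                    u , s≤u , antitone ne-α ne-δ α⊆δ r
    ; ≤∘R-back  = λ {α} ne _ {t} (u , s≤u , r) →
                    (t , α) , ((u , α) , s≤u , ne , ⊆-refl , r) , refl
    ; ≥∘R-forth = λ ne-α ((u , _) , u≤s , ne-δ , α⊆δ , r) →
                    u , u≤s , antitone ne-α ne-δ α⊆δ r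
    ; ≥∘R-back  = λ {α} ne _ {t} (u , u≤s , r) →
                    (t , α) , ((u , α) , u≤s , ne , ⊆-refl , r) , refl
    }
    where antitone = prestandard⇒R-antitone F prestandard

proposition10 : ∀ (n : ℕ) (A : Form n) → (InLogPreEpi A → InLogStaEpi A) × (InLogStaEpi A → InLogPreEpi A)
proposition10 n A =
    (λ valid F epistemic standard →
       valid F epistemic (standard⇒prestandard F standard))
  , (λ valid F epistemic prestandard →
       let open StandardCover F
           open BoundedMorphism-Truth (projection prestandard)
       in surjective⇒validIn-reflect (λ s → (s , Subset.⊥) , refl) A
            (valid cover (cover-epistemic epistemic) cover-standard))
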